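{- Every graph $G$ that is both fork-free and banner-free satisfies $\chi(G)\le \omega(G)^2$.
   Context: Graphs are finite and simple. A graph $G$ is $H$-free if no induced subgraph of $G$ is isomorphic to $H$. The fork is the graph obtained from $K_{1,3}$ by subdividing one edge once. The banner is the graph on $v_1,\dots,v_5$ where $\{v_1,v_2,v_3,v_4\}$ induces a claw $K_{1,3}$ with center $v_1$ and $v_5$ is adjacent to $v_2,v_3$ but not to $v_1,v_4$. $\chi(G)$ is the chromatic number and $\omega(G)$ the clique number of $G$. -}

module Defs where

open import Data.Nat using (ℕ; suc; _*_)
open import Data.Fin using (Fin; zero; suc)
open import Data.Product using (Σ; _×_; ∃)
open import Relation.Nullary using (¬_; Dec)
open import Relation.Binary.PropositionalEquality using (_≡_; _≢_)
open import Function using (_⇔_)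
open import Level using (0ℓ)

record Graph (n : ℕ) : Set₁ where
  field
    Adj   : Fin n → Fin n → Set
    adj?  : (u v : Fin n) → Dec (Adj u v)
    irrefl : (v : Fin n) → ¬ Adj v v
    sym   : {u v : Fin n} → Adj u v → Adj v u
open Graph public

InducedCopy : {k n : ℕ} → Graph k → Graph n → Set
InducedCopy {k} {n} H G =
  Σ (Fin k → Fin n) λ f →
    ((i j : Fin k) → f i ≡ f j → i ≡ j) ×
    ((i j : Fin k) → Adj G (f i) (f j) ⇔ Adj H i j)

_-free_ : {k n : ℕ} → Graph k → Graph n → Set
H -free G = ¬ InducedCopy H G

open import Data.Bool using (Bool; true; false; T; _∨_)
open import Data.Bool.Properties using (T?)


-- Fork: vertices 0..4; claw with center 0 and leaves 1,2,3, edge 0-3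
-- subdivided: edges 0-1, 0-2, 0-3, 3-4.
forkE : Fin 5 → Fin 5 → Bool
forkE zero (suc zero) = true
forkE zero (suc (suc zero)) = true
forkE zero (suc (suc (suc zero))) = true
forkE (suc (suc (suc zero))) (suc (suc (suc (suc zero)))) = true
forkE _ _ = false

-- Banner: v1..v5 as 0..4; claw center 0 with leaves 1,2,3; vertex 4
-- adjacent to 1 and 2.  Edges 0-1, 0-2, 0-3, 4-1, 4-2.
bannerE : Fin 5 → Fin 5 → Bool
bannerE zero (suc zero) = true
bannerE zero (suc (suc zero)) = true
bannerE zero (suc (suc (suc zero))) = true
bannerE (suc (suc (suc (suc zero)))) (suc zero) = true
bannerE (suc (suc (suc (suc zero)))) (suc (suc zero)) = true
bannerE _ _ = false

symClose : {k : ℕ} → (Fin k → Fin k → Bool) → Fin k → Fin k → Bool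
symClose e u v = e u v ∨ e v u

fromEdges : {k : ℕ} (e : Fin k → Fin k → Bool) →
            ((v : Fin k) → ¬ T (symClose e v v)) → Graph k
fromEdges e irr = record
  { Adj = λ u v → T (symClose e u v)
  ; adj? = λ u v → T? (symClose e u v)
  ; irrefl = irr
  ; sym = λ {u} {v} → swap u v
  }
  where
  swap : ∀ u v → T (symClose e u v) → T (symClose e v u)
  swap u v p with e u v | e v u
  ... | true  | true  = p
  ... | true  | false = p
  ... | false | true  = p
  ... | false | false = p

forkIrr : (v : Fin 5) → ¬ T (symClose forkE v v)
forkIrr zero ()
forkIrr (suc zero) ()
forkIrr (suc (suc zero)) ()
forkIrr (suc (suc (suc zero))) ()
forkIrr (suc (suc (suc (suc zero)))) ()

bannerIrr : (v : Fin 5) → ¬ T (symClose bannerE v v)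
bannerIrr zero ()
bannerIrr (suc zero) ()
bannerIrr (suc (suc zero)) ()
bannerIrr (suc (suc (suc zero))) ()
bannerIrr (suc (suc (suc (suc zero)))) ()

Fork : Graph 5
Fork = fromEdges forkE forkIrr

Banner : Graph 5
Banner = fromEdges bannerE bannerIrr

Clique : {n : ℕ} → Graph n → ℕ → Set
Clique {n} G k =
  Σ (Fin k → Fin n) λ f →
    ((i j : Fin k) → f i ≡ f j → i ≡ j) ×
    ((i j : Fin k) → i ≢ j → Adj G (f i) (f j))

CliqueNumber : {n : ℕ} → Graph n → ℕ → Set
CliqueNumber G w = Clique G w × ¬ Clique G (suc w)

Colouring : {n : ℕ} → Graph n → ℕ → Set
Colouring {n} G c =
  Σ (Fin n → Fin c) λ col → (u v : Fin n) → Adj G u v → col u ≢ col v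

χ≤ : {n : ℕ} → Graph n → ℕ → Set
χ≤ G c = Colouring G c

-- Induction on a vertex set P with ω(P) ≤ k, colouring P with k² colours. If some vertex v of P is
-- not the centre of a claw in P, its neighbourhood in P has α ≤ 2 and ω ≤ k − 1, hence fewer than k²
-- vertices by Ramsey's bound, and v is coloured greedily after P − v. Otherwise choose a vertex c₀ of
-- P and an independent set S in its neighbourhood with |S| maximum over all vertices of P; |S| ≥ 3.
-- As G has no induced fork or banner, a vertex anticomplete to S with a neighbour mixed on S would
-- not be a claw centre. Hence either the vertices anticomplete to S are anticomplete to the rest of
-- P, or there are none and P is the join of the vertices complete to S and the rest. Both sides are
-- coloured by induction, with k² colours in the first case and a² + (k − a)² ≤ k² in the second.

module Submission where

open import Defs hiding (sym)
open import Data.Nat using (ℕ; zero; suc; _+_; _∸_; _*_; _≤_; _<_; z≤n; s≤s)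
open import Data.Nat.Properties
open import Data.Nat.Induction using (<-wellFounded)
open import Data.Fin as Fin using (Fin; zero; suc; toℕ; #_)
import Data.Fin.Properties as Finₚ
open import Data.Fin.Subset as Subset
  using (Subset; inside; outside; _∈_; _∉_; _⊆_; _⊂_; _∪_; _∩_; _─_; _-_; ⁅_⁆; ∣_∣; Nonempty; Empty)
open import Data.Fin.Subset.Properties
  using (_∈?_; _⊆?_; nonempty?; anySubset?; Lift?; ∉⊥; ∈⊤; x∈⁅x⁆; x∈⁅y⁆⇒x≡y; x∉⁅y⁆⇒x≢y; ∣⁅x⁆∣≡1;
         x∈p∪q⁻; x∈p∪q⁺; x∈p∩q⁺; p∩q⊆p; p∩q⊆q; p─q⊆p; x∈p∧x∉q⇒x∈p─q; x∈p∧x≢y⇒x∈p-y;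
         Empty-unique; ∣⊥∣≡0; ∣p∣≤n; p⊆q⇒∣p∣≤∣q∣; p⊂q⇒∣p∣<∣q∣; x∈p⇒∣p-x∣<∣p∣; p∩q≢∅⇒∣p─q∣<∣p∣)
open import Data.Vec.Base using (_∷_; []; here; there; tabulate; lookup)
open import Data.Vec.Properties using ([]=⇒lookup; lookup⇒[]=; lookup∘tabulate)
open import Data.Bool.Base using (T; true; false)
open import Data.Unit using (tt)
open import Data.Empty using (⊥; ⊥-elim)
open import Data.Product using (Σ-syntax; ∃-syntax; _×_; _,_; proj₁; proj₂)
open import Data.Sum using (_⊎_; inj₁; inj₂)
open import Function using (_∘_; _⇔_; mk⇔; Equivalence)
open import Induction.WellFounded using (Acc; acc)
open import Level using (0ℓ)
open import Relation.Binary.Definitions using (tri<; tri≈; tri>)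
open import Relation.Binary.PropositionalEquality using (_≡_; _≢_; refl; sym; trans; cong; subst; subst₂)
open import Relation.Nullary using (¬_; Dec; yes; no; does)
open import Relation.Nullary.Decidable
  using (_×-dec_; _→-dec_; _⊎-dec_; ¬?; map′; dec-true; decidable-stable; toWitness)
open import Relation.Unary using (Pred; Decidable)

private
  variable
    a j k m : ℕ
    u : Fin m
    p q P X Y S S′ : Subset m
    x y : Fin m

toSubset : {P : Pred (Fin m) 0ℓ} → Decidable P → Subset m
toSubset P? = tabulate (does ∘ P?)

module _ {P : Pred (Fin m) 0ℓ} (P? : Decidable P) where

  ∈toSubset⁺ : P x → x ∈ toSubset P?
  ∈toSubset⁺ {x} px = lookup⇒[]= x _ (trans (lookup∘tabulate _ x) (dec-true (P? x) px))

  ∈toSubset⁻ : x ∈ toSubset P? → P x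
  ∈toSubset⁻ {x} x∈ with P? x | trans (sym (lookup∘tabulate _ x)) ([]=⇒lookup x∈)
  ... | yes px | _  = px
  ... | no _   | ()

∣p∪q∣≤∣p∣+∣q∣ : (p q : Subset m) → ∣ p ∪ q ∣ ≤ ∣ p ∣ + ∣ q ∣
∣p∪q∣≤∣p∣+∣q∣ []            []            = z≤n
∣p∪q∣≤∣p∣+∣q∣ (inside ∷ p)  (inside ∷ q)  =
  s≤s (≤-trans (∣p∪q∣≤∣p∣+∣q∣ p q) (≤-trans (n≤1+n _) (≤-reflexive (sym (+-suc ∣ p ∣ ∣ q ∣)))))
∣p∪q∣≤∣p∣+∣q∣ (inside ∷ p)  (outside ∷ q) = s≤s (∣p∪q∣≤∣p∣+∣q∣ p q)
∣p∪q∣≤∣p∣+∣q∣ (outside ∷ p) (inside ∷ q)  =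
  ≤-trans (s≤s (∣p∪q∣≤∣p∣+∣q∣ p q)) (≤-reflexive (sym (+-suc ∣ p ∣ ∣ q ∣)))
∣p∪q∣≤∣p∣+∣q∣ (outside ∷ p) (outside ∷ q) = ∣p∪q∣≤∣p∣+∣q∣ p q

∣p∣+∣q∣≤∣p∪q∣ : (p q : Subset m) → (∀ {x} → x ∈ p → x ∉ q) → ∣ p ∣ + ∣ q ∣ ≤ ∣ p ∪ q ∣
∣p∣+∣q∣≤∣p∪q∣ []            []            _        = z≤n
∣p∣+∣q∣≤∣p∪q∣ (inside ∷ p)  (inside ∷ q)  disjoint = ⊥-elim (disjoint here here)
∣p∣+∣q∣≤∣p∪q∣ (inside ∷ p)  (outside ∷ q) disjoint =
  s≤s (∣p∣+∣q∣≤∣p∪q∣ p q (λ x∈p x∈q → disjoint (there x∈p) (there x∈q)))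
∣p∣+∣q∣≤∣p∪q∣ (outside ∷ p) (inside ∷ q)  disjoint =
  ≤-trans (≤-reflexive (+-suc ∣ p ∣ ∣ q ∣))
          (s≤s (∣p∣+∣q∣≤∣p∪q∣ p q (λ x∈p x∈q → disjoint (there x∈p) (there x∈q))))
∣p∣+∣q∣≤∣p∪q∣ (outside ∷ p) (outside ∷ q) disjoint =
  ∣p∣+∣q∣≤∣p∪q∣ p q (λ x∈p x∈q → disjoint (there x∈p) (there x∈q))

x∈p─q⇒x∉q : (p q : Subset m) → x ∈ p ─ q → x ∉ q
x∈p─q⇒x∉q (inside ∷ p) (outside ∷ q) here      ()
x∈p─q⇒x∉q (_ ∷ p)      (_ ∷ q)       (there x∈) (there x∈q) = x∈p─q⇒x∉q p q x∈ x∈q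

x∈p-y⇒x≢y : x ∈ p - y → x ≢ y
x∈p-y⇒x≢y {p = p} {y} x∈ = x∉⁅y⁆⇒x≢y (x∈p─q⇒x∉q p ⁅ y ⁆ x∈)

∣p─q∣<∣p∣ : q ⊆ p → x ∈ q → ∣ p ─ q ∣ < ∣ p ∣
∣p─q∣<∣p∣ {q = q} {p} q⊆p x∈q = p∩q≢∅⇒∣p─q∣<∣p∣ p q (_ , x∈p∩q⁺ (q⊆p x∈q , x∈q))

x∈p⇒⁅x⁆⊆p : x ∈ p → ⁅ x ⁆ ⊆ p
x∈p⇒⁅x⁆⊆p {x = x} {p} x∈p y∈⁅x⁆ = subst (_∈ p) (sym (x∈⁅y⁆⇒x≡y x y∈⁅x⁆)) x∈p

x∈⁅y⁆∪p⁻ : x ∈ ⁅ y ⁆ ∪ p → x ≡ y ⊎ x ∈ p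
x∈⁅y⁆∪p⁻ {y = y} {p} x∈ with x∈p∪q⁻ ⁅ y ⁆ p x∈
... | inj₁ x∈⁅y⁆ = inj₁ (x∈⁅y⁆⇒x≡y y x∈⁅y⁆)
... | inj₂ x∈p   = inj₂ x∈p

⁅x⁆∪p⊆q : x ∈ q → p ⊆ q → ⁅ x ⁆ ∪ p ⊆ q
⁅x⁆∪p⊆q x∈q p⊆q y∈ with x∈⁅y⁆∪p⁻ y∈
... | inj₁ refl = x∈q
... | inj₂ y∈p  = p⊆q y∈p

∣p∣≤1+∣p-x∣ : (p : Subset m) (x : Fin m) → ∣ p ∣ ≤ suc ∣ p - x ∣
∣p∣≤1+∣p-x∣ p x = begin
  ∣ p ∣                 ≤⟨ p⊆q⇒∣p∣≤∣q∣ p⊆⁅x⁆∪[p-x] ⟩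
  ∣ ⁅ x ⁆ ∪ (p - x) ∣   ≤⟨ ∣p∪q∣≤∣p∣+∣q∣ ⁅ x ⁆ (p - x) ⟩
  ∣ ⁅ x ⁆ ∣ + ∣ p - x ∣ ≡⟨ cong (_+ ∣ p - x ∣) (∣⁅x⁆∣≡1 x) ⟩
  suc ∣ p - x ∣         ∎
  where
  open ≤-Reasoning
  p⊆⁅x⁆∪[p-x] : p ⊆ ⁅ x ⁆ ∪ (p - x)
  p⊆⁅x⁆∪[p-x] {y} y∈p with y Finₚ.≟ x
  ... | yes refl = x∈p∪q⁺ (inj₁ (x∈⁅x⁆ x))
  ... | no y≢x   = x∈p∪q⁺ (inj₂ (x∈p∧x≢y⇒x∈p-y y∈p y≢x))

Empty⇒∣p∣≡0 : Empty p → ∣ p ∣ ≡ 0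
Empty⇒∣p∣≡0 {m} empty = trans (cong ∣_∣ (Empty-unique empty)) (∣⊥∣≡0 m)

0<∣p∣⇒Nonempty : 0 < ∣ p ∣ → Nonempty p
0<∣p∣⇒Nonempty {p = p} 0<∣p∣ with nonempty? p
... | yes nonempty = nonempty
... | no  empty    = ⊥-elim (<⇒≢ 0<∣p∣ (sym (Empty⇒∣p∣≡0 empty)))

∈-avoiding : 1 < ∣ p ∣ → ∀ y → ∃[ x ] x ∈ p × x ≢ y
∈-avoiding {p = p} 1<∣p∣ y with 0<∣p∣⇒Nonempty {p = p - y} (≤-pred (≤-trans 1<∣p∣ (∣p∣≤1+∣p-x∣ p y)))
... | x , x∈p-y = x , p─q⊆p p ⁅ y ⁆ x∈p-y , x∈p-y⇒x≢y x∈p-y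

∈-avoiding₂ : 2 < ∣ p ∣ → ∀ y z → ∃[ x ] x ∈ p × x ≢ y × x ≢ z
∈-avoiding₂ {p = p} 2<∣p∣ y z with ∈-avoiding {p = p - y} (≤-pred (≤-trans 2<∣p∣ (∣p∣≤1+∣p-x∣ p y))) z
... | x , x∈p-y , x≢z = x , p─q⊆p p ⁅ y ⁆ x∈p-y , x∈p-y⇒x≢y x∈p-y , x≢z

injective⇒≤∣p∣ : (f : Fin k → Fin m) → (∀ i j → f i ≡ f j → i ≡ j) → (∀ i → f i ∈ p) → k ≤ ∣ p ∣
injective⇒≤∣p∣ {zero}  f _   _   = z≤n
injective⇒≤∣p∣ {suc k} {p = p} f inj f∈p = ≤-trans (s≤s rest) (x∈p⇒∣p-x∣<∣p∣ (f∈p zero))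
  where
  rest : k ≤ ∣ p - f zero ∣
  rest = injective⇒≤∣p∣ (f ∘ suc) (λ i j eq → Finₚ.suc-injective (inj (suc i) (suc j) eq))
           (λ i → x∈p∧x≢y⇒x∈p-y (f∈p (suc i)) (λ eq → Finₚ.0≢1+n (inj zero (suc i) (sym eq))))

enumerate : (p : Subset m) → Σ[ f ∈ (Fin ∣ p ∣ → Fin m) ] (∀ i → f i ∈ p) × (∀ i j → f i ≡ f j → i ≡ j)
enumerate []            = (λ ()) , (λ ()) , (λ ())
enumerate (outside ∷ p) with enumerate p
... | f , f∈p , inj = suc ∘ f , there ∘ f∈p , λ i j eq → inj i j (Finₚ.suc-injective eq)
enumerate (inside ∷ p)  with enumerate p
... | f , f∈p , inj = g , g∈ , g-inj
  where
  g : Fin (suc ∣ p ∣) → Fin _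
  g zero    = zero
  g (suc i) = suc (f i)
  g∈ : ∀ i → g i ∈ inside ∷ p
  g∈ zero    = here
  g∈ (suc i) = there (f∈p i)
  g-inj : ∀ i j → g i ≡ g j → i ≡ j
  g-inj zero    zero    _  = refl
  g-inj (suc i) (suc j) eq = cong suc (inj i j (Finₚ.suc-injective eq))

maximum : {P : Pred (Subset m) 0ℓ} → Decidable P → P q →
          Σ[ p ∈ Subset m ] P p × (∀ {r} → P r → ∣ r ∣ ≤ ∣ p ∣)
maximum {m} {q} {P} P? Pq = search m (λ {r} _ → ∣p∣≤n r)
  where
  search : ∀ k → (∀ {r} → P r → ∣ r ∣ ≤ k) → Σ[ p ∈ Subset m ] P p × (∀ {r} → P r → ∣ r ∣ ≤ ∣ p ∣)
  search k bound with anySubset? (λ r → P? r ×-dec k ≤? ∣ r ∣)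
  ... | yes (p , Pp , k≤∣p∣) = p , Pp , λ Pr → ≤-trans (bound Pr) k≤∣p∣
  search zero    bound | no _    = q , Pq , λ Pr → ≤-trans (bound Pr) z≤n
  search (suc k) bound | no none = search k (λ {r} Pr → ≤-pred (≰⇒> (λ 1+k≤∣r∣ → none (r , Pr , 1+k≤∣r∣))))

unusedValue : (f : Fin m → ℕ) (p : Subset m) {c : ℕ} → ∣ p ∣ < c →
              ∃[ i ] i < c × (∀ {x} → x ∈ p → f x ≢ i)
unusedValue f p {c} ∣p∣<c = fromDecision (Finₚ.all? used?)
  where
  Used : Fin c → Set
  Used i = ∃[ x ] x ∈ p × f x ≡ toℕ i
  used? : ∀ i → Dec (Used i)
  used? i = Finₚ.any? λ x → (x ∈? p) ×-dec (f x ≟ toℕ i)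
  fromDecision : Dec (∀ i → Used i) → ∃[ i ] i < c × (∀ {x} → x ∈ p → f x ≢ i)
  fromDecision (no notAllUsed) with Finₚ.¬∀⟶∃¬ c Used used? notAllUsed
  ... | i , unused = toℕ i , Finₚ.toℕ<n i , λ x∈p fx≡i → unused (_ , x∈p , fx≡i)
  fromDecision (yes allUsed) = ⊥-elim (<⇒≱ ∣p∣<c (injective⇒≤∣p∣ user user-injective (proj₁ ∘ proj₂ ∘ allUsed)))
    where
    user : Fin c → Fin _
    user = proj₁ ∘ allUsed
    user-injective : ∀ i j → user i ≡ user j → i ≡ j
    user-injective i j eq = Finₚ.toℕ-injective
      (trans (sym (proj₂ (proj₂ (allUsed i)))) (trans (cong f eq) (proj₂ (proj₂ (allUsed j)))))

glue : Subset m → (Fin m → ℕ) → (Fin m → ℕ) → Fin m → ℕ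
glue A f g x with x ∈? A
... | yes _ = f x
... | no  _ = g x

glue-view : (A : Subset m) (f g : Fin m → ℕ) → x ∈ p →
            (x ∈ A × glue A f g x ≡ f x) ⊎ (x ∈ p ─ A × glue A f g x ≡ g x)
glue-view {x = x} A f g x∈p with x ∈? A
... | yes x∈A = inj₁ (x∈A , refl)
... | no  x∉A = inj₂ (x∈p∧x∉q⇒x∈p─q x∈p x∉A , refl)

a²+[k∸a]²≤k² : ∀ {a k} → a ≤ k → a * a + (k ∸ a) * (k ∸ a) ≤ k * k
a²+[k∸a]²≤k² {a} {k} a≤k = begin
  a * a + b * b             ≤⟨ +-mono-≤ (*-monoʳ-≤ a (m≤m+n a b)) (*-monoʳ-≤ b (m≤n+m b a)) ⟩
  a * (a + b) + b * (a + b) ≡⟨ sym (*-distribʳ-+ (a + b) a b) ⟩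
  (a + b) * (a + b)         ≡⟨ cong (λ c → c * c) (m+[n∸m]≡n a≤k) ⟩
  k * k                     ∎
  where
  open ≤-Reasoning
  b = k ∸ a

-- Homogeneous sets and Ramsey's bound

-- ramseyBound i j = C(i + j, i) − 1, the Erdős–Szekeres bound for α ≤ i and ω ≤ j.
ramseyBound : ℕ → ℕ → ℕ
ramseyBound zero    _       = 0
ramseyBound (suc i) zero    = 0
ramseyBound (suc i) (suc j) = suc (ramseyBound (suc i) j + ramseyBound i (suc j))

ramseyBound-1 : ∀ j → ramseyBound 1 j ≡ j
ramseyBound-1 zero    = refl
ramseyBound-1 (suc j) = cong suc (trans (+-identityʳ _) (ramseyBound-1 j))

ramseyBound-2 : ∀ j → ramseyBound 2 j < suc j * suc j
ramseyBound-2 zero    = s≤s z≤n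
ramseyBound-2 (suc j) = begin-strict
  suc (ramseyBound 2 j + ramseyBound 1 s) ≡⟨ cong (λ r → suc (ramseyBound 2 j + r)) (ramseyBound-1 s) ⟩
  suc (ramseyBound 2 j + s)              ≤⟨ +-monoˡ-≤ s (ramseyBound-2 j) ⟩
  s * s + s                              ≡⟨ +-comm (s * s) s ⟩
  s + s * s                              <⟨ s≤s (m≤n+m (s + s * s) s) ⟩
  suc (s + (s + s * s))                  ≡⟨ cong (λ t → suc (s + t)) (sym (*-suc s s)) ⟩
  suc s * suc s                          ∎
  where
  open ≤-Reasoning
  s = suc j

module Homogeneous {n : ℕ} (R : Fin n → Fin n → Set) (R? : ∀ x y → Dec (R x y))
                   (R-irrefl : ∀ x → ¬ R x x) (R-sym : ∀ {x y} → R x y → R y x) where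

  IsHomogeneous : Subset n → Set
  IsHomogeneous S = ∀ {x y} → x ∈ S → y ∈ S → x ≢ y → R x y

  Has : Subset n → ℕ → Set
  Has X k = ∃[ S ] S ⊆ X × IsHomogeneous S × k ≤ ∣ S ∣

  Bounded : Subset n → ℕ → Set
  Bounded X k = ¬ Has X (suc k)

  isHomogeneous? : Decidable IsHomogeneous
  isHomogeneous? S = map′ (λ h x∈S y∈S → h _ _ x∈S y∈S) (λ h _ _ → h)
    (Finₚ.all? λ x → Finₚ.all? λ y → (x ∈? S) →-dec (y ∈? S) →-dec ¬? (x Finₚ.≟ y) →-dec R? x y)

  has? : ∀ X k → Dec (Has X k)
  has? X k = anySubset? λ S → (S ⊆? X) ×-dec isHomogeneous? S ×-dec (k ≤? ∣ S ∣)

  has-⊆ : X ⊆ Y → Has X k → Has Y k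
  has-⊆ X⊆Y (S , S⊆X , hom , k≤∣S∣) = S , X⊆Y ∘ S⊆X , hom , k≤∣S∣

  bounded-⊆ : X ⊆ Y → Bounded Y k → Bounded X k
  bounded-⊆ X⊆Y bounded = bounded ∘ has-⊆ X⊆Y

  has-≤ : j ≤ k → Has X k → Has X j
  has-≤ j≤k (S , S⊆X , hom , k≤∣S∣) = S , S⊆X , hom , ≤-trans j≤k k≤∣S∣

  has⇒≤ : Has X a → Bounded X k → a ≤ k
  has⇒≤ has bounded = ≤-pred (≰⇒> (λ 1+k≤a → bounded (has-≤ 1+k≤a has)))

  isHomogeneous-⊆ : S ⊆ S′ → IsHomogeneous S′ → IsHomogeneous S
  isHomogeneous-⊆ S⊆S′ hom x∈S y∈S = hom (S⊆S′ x∈S) (S⊆S′ y∈S)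

  has-self : IsHomogeneous S → Has S ∣ S ∣
  has-self hom = _ , (λ x∈S → x∈S) , hom , ≤-refl

  has-⁅⁆ : (x : Fin n) → Has ⁅ x ⁆ 1
  has-⁅⁆ x = _ , (λ y∈ → y∈) , hom , ≤-reflexive (sym (∣⁅x⁆∣≡1 x))
    where
    hom : IsHomogeneous ⁅ x ⁆
    hom y∈ z∈ y≢z = ⊥-elim (y≢z (trans (x∈⁅y⁆⇒x≡y x y∈) (sym (x∈⁅y⁆⇒x≡y x z∈))))

  isHomogeneous-∪ : IsHomogeneous S → IsHomogeneous S′ → (∀ {x y} → x ∈ S → y ∈ S′ → R x y) →
                    IsHomogeneous (S ∪ S′)
  isHomogeneous-∪ {S} {S′} homS homS′ cross x∈ y∈ x≢y with x∈p∪q⁻ S S′ x∈ | x∈p∪q⁻ S S′ y∈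
  ... | inj₁ x∈S  | inj₁ y∈S  = homS x∈S y∈S x≢y
  ... | inj₁ x∈S  | inj₂ y∈S′ = cross x∈S y∈S′
  ... | inj₂ x∈S′ | inj₁ y∈S  = R-sym (cross y∈S x∈S′)
  ... | inj₂ x∈S′ | inj₂ y∈S′ = homS′ x∈S′ y∈S′ x≢y

  has-∪ : ∀ {b} → (∀ {x y} → x ∈ X → y ∈ Y → R x y) → Has X a → Has Y b → Has (X ∪ Y) (a + b)
  has-∪ {X} {Y} cross (S , S⊆X , homS , a≤∣S∣) (S′ , S′⊆Y , homS′ , b≤∣S′∣) =
    S ∪ S′ , S∪S′⊆X∪Y , isHomogeneous-∪ homS homS′ (λ x∈S y∈S′ → cross (S⊆X x∈S) (S′⊆Y y∈S′)) ,
    ≤-trans (+-mono-≤ a≤∣S∣ b≤∣S′∣) (∣p∣+∣q∣≤∣p∪q∣ S S′ disjoint)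
    where
    S∪S′⊆X∪Y : S ∪ S′ ⊆ X ∪ Y
    S∪S′⊆X∪Y x∈ with x∈p∪q⁻ S S′ x∈
    ... | inj₁ x∈S  = x∈p∪q⁺ (inj₁ (S⊆X x∈S))
    ... | inj₂ x∈S′ = x∈p∪q⁺ (inj₂ (S′⊆Y x∈S′))
    disjoint : ∀ {x} → x ∈ S → x ∉ S′
    disjoint {x} x∈S x∈S′ = R-irrefl x (cross (S⊆X x∈S) (S′⊆Y x∈S′))

  bounded-0⇒Empty : Bounded X 0 → Empty X
  bounded-0⇒Empty bounded (x , x∈X) = bounded (has-⊆ (x∈p⇒⁅x⁆⊆p x∈X) (has-⁅⁆ x))

  Nbhd : Fin n → Subset n
  Nbhd u = toSubset (R? u)

  has-extend : u ∈ X → Has (X ∩ Nbhd u) k → Has X (suc k)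
  has-extend {u} {X} u∈X has = has-⊆ (⁅x⁆∪p⊆q u∈X (p∩q⊆p _ _)) (has-∪ cross (has-⁅⁆ u) has)
    where
    cross : ∀ {x y} → x ∈ ⁅ u ⁆ → y ∈ X ∩ Nbhd u → R x y
    cross x∈ y∈ rewrite x∈⁅y⁆⇒x≡y u x∈ = ∈toSubset⁻ (R? u) (p∩q⊆q _ _ y∈)

  bounded-nbhd : u ∈ X → Bounded X (suc k) → Bounded (X ∩ Nbhd u) k
  bounded-nbhd u∈X bounded = bounded ∘ has-extend u∈X

  bounded⇒tight : Bounded X k → ∃[ a ] a ≤ k × Has X a × Bounded X a
  bounded⇒tight {X} bounded with maximum {q = Subset.⊥} (λ S → (S ⊆? X) ×-dec isHomogeneous? S)
                                   ((λ x∈ → ⊥-elim (∉⊥ x∈)) , λ x∈ → ⊥-elim (∉⊥ x∈))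
  ... | S , (S⊆X , homS) , largest = ∣ S ∣ , has⇒≤ hasS bounded , hasS , noLarger
    where
    hasS : Has X ∣ S ∣
    hasS = S , S⊆X , homS , ≤-refl
    noLarger : Bounded X ∣ S ∣
    noLarger (T , T⊆X , homT , 1+∣S∣≤∣T∣) = <⇒≱ 1+∣S∣≤∣T∣ (largest (T⊆X , homT))

Twins : Graph m → Fin m → Fin m → Set
Twins H i j = ∀ l → (Adj H l i → Adj H l j) × (Adj H l j → Adj H l i)

twins? : (H : Graph m) → ∀ i j → Dec (Twins H i j)
twins? H i j = Finₚ.all? λ l → (adj? H l i →-dec adj? H l j) ×-dec (adj? H l j →-dec adj? H l i)

OnlyTwins₁₂ : Graph 5 → Set
OnlyTwins₁₂ H = ∀ i j → Twins H i j → i ≡ j ⊎ (i ≡ # 1 × j ≡ # 2) ⊎ (i ≡ # 2 × j ≡ # 1)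

onlyTwins₁₂? : ∀ H → Dec (OnlyTwins₁₂ H)
onlyTwins₁₂? H = Finₚ.all? λ i → Finₚ.all? λ j → twins? H i j →-dec
  (i Finₚ.≟ j ⊎-dec (i Finₚ.≟ # 1 ×-dec j Finₚ.≟ # 2) ⊎-dec (i Finₚ.≟ # 2 ×-dec j Finₚ.≟ # 1))

fork-twins : OnlyTwins₁₂ Fork
fork-twins = toWitness {a? = onlyTwins₁₂? Fork} tt

banner-twins : OnlyTwins₁₂ Banner
banner-twins = toWitness {a? = onlyTwins₁₂? Banner} tt

-- Cliques, independent sets and colourings of induced subgraphs

module _ {n : ℕ} (G : Graph n) where

  adj-sym : Adj G x y → Adj G y x
  adj-sym = Graph.sym G

  -- The inequality makes the relation irreflexive, as Homogeneous requires.
  NonAdj : Fin n → Fin n → Set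
  NonAdj x y = ¬ Adj G x y × x ≢ y

  nonAdj? : ∀ x y → Dec (NonAdj x y)
  nonAdj? x y = ¬? (adj? G x y) ×-dec ¬? (x Finₚ.≟ y)

  module Clique = Homogeneous (Adj G) (adj? G) (irrefl G) adj-sym
  module Independent = Homogeneous NonAdj nonAdj? (λ x (_ , x≢x) → x≢x refl)
                                   (λ (x≁y , x≢y) → x≁y ∘ adj-sym , x≢y ∘ sym)

  infix 4 ω[_]≤_ α[_]≤_ χ[_]≤_

  ω[_]≤_ : Subset n → ℕ → Set
  ω[ X ]≤ k = Clique.Bounded X k

  α[_]≤_ : Subset n → ℕ → Set
  α[ X ]≤ k = Independent.Bounded X k

  N : Fin n → Subset n
  N = Clique.Nbhd

  χ[_]≤_ : Subset n → ℕ → Set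
  χ[ P ]≤ c = Σ[ col ∈ (Fin n → ℕ) ] (∀ {x} → x ∈ P → col x < c) ×
                                      (∀ {x y} → x ∈ P → y ∈ P → Adj G x y → col x ≢ col y)

  Complete : Subset n → Subset n → Set
  Complete A B = ∀ {x y} → x ∈ A → y ∈ B → Adj G x y

  Anticomplete : Subset n → Subset n → Set
  Anticomplete A B = ∀ {x y} → x ∈ A → y ∈ B → ¬ Adj G x y

  ∈P∩N : x ∈ P → Adj G u x → x ∈ P ∩ N u
  ∈P∩N {u = u} x∈P u~x = x∈p∩q⁺ (x∈P , ∈toSubset⁺ (adj? G u) u~x)

  ramsey : ∀ i j {X} → α[ X ]≤ i → ω[ X ]≤ j → ∣ X ∣ ≤ ramseyBound i j
  ramsey zero    j       α≤0 _   = ≤-reflexive (Empty⇒∣p∣≡0 (Independent.bounded-0⇒Empty α≤0))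
  ramsey (suc i) zero    _   ω≤0 = ≤-reflexive (Empty⇒∣p∣≡0 (Clique.bounded-0⇒Empty ω≤0))
  ramsey (suc i) (suc j) {X} α≤ ω≤ with nonempty? X
  ... | no  empty      = ≤-trans (≤-reflexive (Empty⇒∣p∣≡0 empty)) z≤n
  ... | yes (u , u∈X) = begin
    ∣ X ∣                 ≤⟨ p⊆q⇒∣p∣≤∣q∣ X⊆⁅u⁆∪A∪B ⟩
    ∣ ⁅ u ⁆ ∪ (A ∪ B) ∣   ≤⟨ ∣p∪q∣≤∣p∣+∣q∣ ⁅ u ⁆ (A ∪ B) ⟩
    ∣ ⁅ u ⁆ ∣ + ∣ A ∪ B ∣ ≡⟨ cong (_+ ∣ A ∪ B ∣) (∣⁅x⁆∣≡1 u) ⟩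
    suc ∣ A ∪ B ∣         ≤⟨ s≤s (∣p∪q∣≤∣p∣+∣q∣ A B) ⟩
    suc (∣ A ∣ + ∣ B ∣)   ≤⟨ s≤s (+-mono-≤ (ramsey (suc i) j (Independent.bounded-⊆ (p∩q⊆p _ _) α≤)
                                                                (Clique.bounded-nbhd u∈X ω≤))
                                           (ramsey i (suc j) (Independent.bounded-nbhd u∈X α≤)
                                                                (Clique.bounded-⊆ (p∩q⊆p _ _) ω≤))) ⟩
    ramseyBound (suc i) (suc j) ∎
    where
    open ≤-Reasoning
    A = X ∩ N u
    B = X ∩ Independent.Nbhd u
    X⊆⁅u⁆∪A∪B : X ⊆ ⁅ u ⁆ ∪ (A ∪ B)
    X⊆⁅u⁆∪A∪B {x} x∈X with x Finₚ.≟ u | adj? G u x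
    ... | yes refl | _       = x∈p∪q⁺ (inj₁ (x∈⁅x⁆ u))
    ... | no  x≢u  | yes u~x = x∈p∪q⁺ (inj₂ (x∈p∪q⁺ (inj₁ (x∈p∩q⁺ (x∈X , ∈toSubset⁺ (adj? G u) u~x)))))
    ... | no  x≢u  | no  u≁x =
      x∈p∪q⁺ (inj₂ (x∈p∪q⁺ (inj₂ (x∈p∩q⁺ (x∈X , ∈toSubset⁺ (nonAdj? u) (u≁x , x≢u ∘ sym))))))

  χ-empty : ∀ {c} → Empty P → χ[ P ]≤ c
  χ-empty empty = (λ _ → 0) , (λ x∈P → ⊥-elim (empty (_ , x∈P))) , (λ x∈P → ⊥-elim (empty (_ , x∈P)))

  χ-≤ : ∀ {c d} → c ≤ d → χ[ P ]≤ c → χ[ P ]≤ d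
  χ-≤ c≤d (col , col< , proper) = col , (λ x∈P → <-≤-trans (col< x∈P) c≤d) , proper

  χ-anticomplete : ∀ {A c} → Anticomplete A (P ─ A) → χ[ A ]≤ c → χ[ P ─ A ]≤ c → χ[ P ]≤ c
  χ-anticomplete {P} {A} {c} anti (f , f< , f-proper) (g , g< , g-proper) = glue A f g , col< , proper
    where
    col< : x ∈ P → glue A f g x < c
    col< x∈P with glue-view A f g x∈P
    ... | inj₁ (x∈A , eq) = subst (_< c) (sym eq) (f< x∈A)
    ... | inj₂ (x∈B , eq) = subst (_< c) (sym eq) (g< x∈B)
    proper : x ∈ P → y ∈ P → Adj G x y → glue A f g x ≢ glue A f g y
    proper x∈P y∈P x~y with glue-view A f g x∈P | glue-view A f g y∈P
    ... | inj₁ (x∈A , ex) | inj₁ (y∈A , ey) = f-proper x∈A y∈A x~y ∘ subst₂ _≡_ ex ey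
    ... | inj₂ (x∈B , ex) | inj₂ (y∈B , ey) = g-proper x∈B y∈B x~y ∘ subst₂ _≡_ ex ey
    ... | inj₁ (x∈A , _)  | inj₂ (y∈B , _)  = ⊥-elim (anti x∈A y∈B x~y)
    ... | inj₂ (x∈B , _)  | inj₁ (y∈A , _)  = ⊥-elim (anti y∈A x∈B (adj-sym x~y))

  χ-complete : ∀ {A a b} → Complete A (P ─ A) → χ[ A ]≤ a → χ[ P ─ A ]≤ b → χ[ P ]≤ a + b
  χ-complete {P} {A} {a} {b} _ (f , f< , f-proper) (g , g< , g-proper) = glue A f shifted , col< , proper
    where
    shifted : Fin _ → ℕ
    shifted x = a + g x
    col< : x ∈ P → glue A f shifted x < a + b
    col< x∈P with glue-view A f shifted x∈P
    ... | inj₁ (x∈A , eq) = subst (_< a + b) (sym eq) (<-≤-trans (f< x∈A) (m≤m+n a b))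
    ... | inj₂ (x∈B , eq) = subst (_< a + b) (sym eq) (+-monoʳ-< a (g< x∈B))
    f<a+g : x ∈ A → f x ≢ a + g y
    f<a+g {y = y} x∈A = <⇒≢ (<-≤-trans (f< x∈A) (m≤m+n a (g y)))
    proper : x ∈ P → y ∈ P → Adj G x y → glue A f shifted x ≢ glue A f shifted y
    proper x∈P y∈P x~y with glue-view A f shifted x∈P | glue-view A f shifted y∈P
    ... | inj₁ (x∈A , ex) | inj₁ (y∈A , ey) = f-proper x∈A y∈A x~y ∘ subst₂ _≡_ ex ey
    ... | inj₂ (x∈B , ex) | inj₂ (y∈B , ey) = g-proper x∈B y∈B x~y ∘ +-cancelˡ-≡ a _ _ ∘ subst₂ _≡_ ex ey
    ... | inj₁ (x∈A , ex) | inj₂ (y∈B , ey) = f<a+g x∈A ∘ subst₂ _≡_ ex ey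
    ... | inj₂ (x∈B , ex) | inj₁ (y∈A , ey) = f<a+g y∈A ∘ sym ∘ subst₂ _≡_ ex ey

  χ-extend : ∀ {c} → u ∈ P → ∣ P ∩ N u ∣ < c → χ[ P - u ]≤ c → χ[ P ]≤ c
  χ-extend {u} {P} {c} u∈P small (f , f< , f-proper) with unusedValue f (P ∩ N u) small
  ... | i , i<c , unused = col , col< , proper
    where
    col : Fin _ → ℕ
    col = glue ⁅ u ⁆ (λ _ → i) f
    col< : x ∈ P → col x < c
    col< x∈P with glue-view ⁅ u ⁆ (λ _ → i) f x∈P
    ... | inj₁ (_ , eq)     = subst (_< c) (sym eq) i<c
    ... | inj₂ (x∈P-u , eq) = subst (_< c) (sym eq) (f< x∈P-u)
    proper : x ∈ P → y ∈ P → Adj G x y → col x ≢ col y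
    proper x∈P y∈P x~y with glue-view ⁅ u ⁆ (λ _ → i) f x∈P | glue-view ⁅ u ⁆ (λ _ → i) f y∈P
    ... | inj₁ (x∈⁅u⁆ , _) | inj₁ (y∈⁅u⁆ , _) =
      ⊥-elim (irrefl G u (subst₂ (Adj G) (x∈⁅y⁆⇒x≡y u x∈⁅u⁆) (x∈⁅y⁆⇒x≡y u y∈⁅u⁆) x~y))
    ... | inj₁ (x∈⁅u⁆ , ex) | inj₂ (_ , ey) rewrite x∈⁅y⁆⇒x≡y u x∈⁅u⁆ =
      unused (∈P∩N y∈P x~y) ∘ sym ∘ subst₂ _≡_ ex ey
    ... | inj₂ (_ , ex) | inj₁ (y∈⁅u⁆ , ey) rewrite x∈⁅y⁆⇒x≡y u y∈⁅u⁆ =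
      unused (∈P∩N x∈P (adj-sym x~y)) ∘ subst₂ _≡_ ex ey
    ... | inj₂ (x∈P-u , ex) | inj₂ (y∈P-u , ey) = f-proper x∈P-u y∈P-u x~y ∘ subst₂ _≡_ ex ey

  degree<k² : u ∈ P → α[ P ∩ N u ]≤ 2 → ω[ P ]≤ k → ∣ P ∩ N u ∣ < k * k
  degree<k² {k = zero}  u∈P _   ω≤0 = ⊥-elim (Clique.bounded-0⇒Empty ω≤0 (_ , u∈P))
  degree<k² {k = suc j} u∈P α≤2 ω≤  = ≤-<-trans (ramsey 2 j α≤2 (Clique.bounded-nbhd u∈P ω≤)) (ramseyBound-2 j)

  χ-join : ∀ {A} → A ⊆ P → Complete A (P ─ A) → ω[ P ]≤ k →
           (∀ j → ω[ A ]≤ j → χ[ A ]≤ j * j) → (∀ j → ω[ P ─ A ]≤ j → χ[ P ─ A ]≤ j * j) → χ[ P ]≤ k * k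
  χ-join {P} {k} {A} A⊆P complete ω≤k colourA colourB with Clique.bounded⇒tight (Clique.bounded-⊆ A⊆P ω≤k)
  ... | a , a≤k , hasA , ωA≤a =
    χ-≤ (a²+[k∸a]²≤k² a≤k) (χ-complete complete (colourA a ωA≤a) (colourB (k ∸ a) ωB≤k∸a))
    where
    A∪[P─A]⊆P : A ∪ (P ─ A) ⊆ P
    A∪[P─A]⊆P x∈ with x∈p∪q⁻ A (P ─ A) x∈
    ... | inj₁ x∈A = A⊆P x∈A
    ... | inj₂ x∈B = p─q⊆p P A x∈B
    ωB≤k∸a : ω[ P ─ A ]≤ k ∸ a
    ωB≤k∸a hasB = ω≤k (Clique.has-⊆ A∪[P─A]⊆P (Clique.has-≤ 1+k≤ (Clique.has-∪ complete hasA hasB)))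
      where
      1+k≤ : suc k ≤ a + suc (k ∸ a)
      1+k≤ = ≤-reflexive (sym (trans (+-suc a (k ∸ a)) (cong suc (m+[n∸m]≡n a≤k))))

  data Split (P : Subset n) : Set where
    complete     : ∀ {A} → A ⊂ P → Nonempty A → Complete A (P ─ A) → Split P
    anticomplete : ∀ {A} → A ⊂ P → Nonempty A → Anticomplete A (P ─ A) → Split P

  χ-split : Split P → (∀ Q → ∣ Q ∣ < ∣ P ∣ → ∀ j → ω[ Q ]≤ j → χ[ Q ]≤ j * j) → ω[ P ]≤ k → χ[ P ]≤ k * k
  χ-split {P} (complete {A} A⊂P (a , a∈A) compl) colour ω≤k =
    χ-join (proj₁ A⊂P) compl ω≤k (colour A (p⊂q⇒∣p∣<∣q∣ A⊂P)) (colour (P ─ A) (∣p─q∣<∣p∣ (proj₁ A⊂P) a∈A))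
  χ-split {P} {k} (anticomplete {A} A⊂P (a , a∈A) anti) colour ω≤k =
    χ-anticomplete anti (colour A (p⊂q⇒∣p∣<∣q∣ A⊂P) k (Clique.bounded-⊆ (proj₁ A⊂P) ω≤k))
                        (colour (P ─ A) (∣p─q∣<∣p∣ (proj₁ A⊂P) a∈A) k (Clique.bounded-⊆ (p─q⊆p P A) ω≤k))

  ¬Clique⇒ω[⊤]≤ : ∀ {w} → ¬ Clique G (suc w) → ω[ Subset.⊤ ]≤ w
  ¬Clique⇒ω[⊤]≤ noClique (Q , _ , Q-clique , 1+w≤∣Q∣) with enumerate Q
  ... | f , f∈Q , f-injective =
    noClique (g , g-injective , λ i j i≢j → Q-clique (f∈Q _) (f∈Q _) (i≢j ∘ g-injective i j))
    where
    g : Fin _ → Fin n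
    g i = f (Fin.inject≤ i 1+w≤∣Q∣)
    g-injective : ∀ i j → g i ≡ g j → i ≡ j
    g-injective i j = Finₚ.inject≤-injective _ _ i j ∘ f-injective _ _

  χ[⊤]⇒Colouring : ∀ {c} → χ[ Subset.⊤ ]≤ c → Colouring G c
  χ[⊤]⇒Colouring (col , col< , proper) =
    (λ x → Fin.fromℕ< (col< ∈⊤)) ,
    λ x y x~y eq → proper ∈⊤ ∈⊤ x~y (Finₚ.fromℕ<-injective _ _ (col< ∈⊤) (col< ∈⊤) eq)

  -- Induced forks and banners

  -- Equal images have equal neighbourhoods, so a map realising H can only identify twins of H.
  realises⇒copy : {H : Graph k} (f : Fin k → Fin n) → (∀ i j → Adj G (f i) (f j) ⇔ Adj H i j) →
                  (∀ i j → Twins H i j → f i ≡ f j → i ≡ j) → InducedCopy H G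
  realises⇒copy {H = H} f realises twins-injective = f , injective , realises
    where
    injective : ∀ i j → f i ≡ f j → i ≡ j
    injective i j eq = twins-injective i j (λ l → transport l i j eq , transport l j i (sym eq)) eq
      where
      transport : ∀ l i j → f i ≡ f j → Adj H l i → Adj H l j
      transport l i j eq =
        Equivalence.to (realises l j) ∘ subst (Adj G (f l)) eq ∘ Equivalence.from (realises l i)

  upper⇒realises : {H : Graph k} (f : Fin k → Fin n) → (∀ i j → i Fin.< j → Adj G (f i) (f j) ⇔ Adj H i j) →
                   ∀ i j → Adj G (f i) (f j) ⇔ Adj H i j
  upper⇒realises {H = H} f upper i j with Finₚ.<-cmp i j
  ... | tri< i<j _ _ = upper i j i<j
  ... | tri≈ _ refl _ = mk⇔ (⊥-elim ∘ irrefl G (f i)) (⊥-elim ∘ irrefl H i)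
  ... | tri> _ _ j<i = mk⇔ (Graph.sym H ∘ Equivalence.to (upper j i j<i) ∘ adj-sym)
                            (adj-sym ∘ Equivalence.from (upper j i j<i) ∘ Graph.sym H)

  copy₅ : {H : Graph 5} → OnlyTwins₁₂ H → (f : Fin 5 → Fin n) → f (# 1) ≢ f (# 2) →
          (∀ i j → i Fin.< j → Adj G (f i) (f j) ⇔ Adj H i j) → InducedCopy H G
  copy₅ {H} onlyTwins f f₁≢f₂ upper = realises⇒copy {H = H} f (upper⇒realises {H = H} f upper) twins-injective
    where
    twins-injective : ∀ i j → Twins H i j → f i ≡ f j → i ≡ j
    twins-injective i j twins eq with onlyTwins i j twins
    ... | inj₁ i≡j                 = i≡j
    ... | inj₂ (inj₁ (refl , refl)) = ⊥-elim (f₁≢f₂ eq)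
    ... | inj₂ (inj₂ (refl , refl)) = ⊥-elim (f₁≢f₂ (sym eq))

  edge : Adj G x y → Adj G x y ⇔ T true
  edge x~y = mk⇔ (λ _ → tt) (λ _ → x~y)

  nonEdge : ¬ Adj G x y → Adj G x y ⇔ T false
  nonEdge x≁y = mk⇔ x≁y λ ()

  ¬fork : Fork -free G → ∀ {a₀ a₁ a₂ a₃ a₄} → a₁ ≢ a₂ →
          Adj G a₀ a₁ → Adj G a₀ a₂ → Adj G a₀ a₃ → ¬ Adj G a₀ a₄ → ¬ Adj G a₁ a₂ → ¬ Adj G a₁ a₃ →
          ¬ Adj G a₁ a₄ → ¬ Adj G a₂ a₃ → ¬ Adj G a₂ a₄ → Adj G a₃ a₄ → ⊥
  ¬fork fork-free {a₀} {a₁} {a₂} {a₃} {a₄} a₁≢a₂ e01 e02 e03 n04 n12 n13 n14 n23 n24 e34 =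
    fork-free (copy₅ {H = Fork} fork-twins f a₁≢a₂ upper)
    where
    f : Fin 5 → Fin n
    f = lookup (a₀ ∷ a₁ ∷ a₂ ∷ a₃ ∷ a₄ ∷ [])
    upper : ∀ i j → i Fin.< j → Adj G (f i) (f j) ⇔ Adj Fork i j
    upper _ zero ()
    upper zero (suc zero) _ = edge e01
    upper (suc _) (suc zero) (s≤s ())
    upper zero (suc (suc zero)) _ = edge e02
    upper (suc zero) (suc (suc zero)) _ = nonEdge n12
    upper (suc (suc _)) (suc (suc zero)) (s≤s (s≤s ()))
    upper zero (suc (suc (suc zero))) _ = edge e03
    upper (suc zero) (suc (suc (suc zero))) _ = nonEdge n13
    upper (suc (suc zero)) (suc (suc (suc zero))) _ = nonEdge n23
    upper (suc (suc (suc _))) (suc (suc (suc zero))) (s≤s (s≤s (s≤s ())))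
    upper zero (suc (suc (suc (suc zero)))) _ = nonEdge n04
    upper (suc zero) (suc (suc (suc (suc zero)))) _ = nonEdge n14
    upper (suc (suc zero)) (suc (suc (suc (suc zero)))) _ = nonEdge n24
    upper (suc (suc (suc zero))) (suc (suc (suc (suc zero)))) _ = edge e34
    upper (suc (suc (suc (suc _)))) (suc (suc (suc (suc zero)))) (s≤s (s≤s (s≤s (s≤s ()))))

  ¬banner : Banner -free G → ∀ {a₀ a₁ a₂ a₃ a₄} → a₁ ≢ a₂ →
            Adj G a₀ a₁ → Adj G a₀ a₂ → Adj G a₀ a₃ → ¬ Adj G a₀ a₄ → ¬ Adj G a₁ a₂ → ¬ Adj G a₁ a₃ →
            Adj G a₁ a₄ → ¬ Adj G a₂ a₃ → Adj G a₂ a₄ → ¬ Adj G a₃ a₄ → ⊥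
  ¬banner banner-free {a₀} {a₁} {a₂} {a₃} {a₄} a₁≢a₂ e01 e02 e03 n04 n12 n13 e14 n23 e24 n34 =
    banner-free (copy₅ {H = Banner} banner-twins f a₁≢a₂ upper)
    where
    f : Fin 5 → Fin n
    f = lookup (a₀ ∷ a₁ ∷ a₂ ∷ a₃ ∷ a₄ ∷ [])
    upper : ∀ i j → i Fin.< j → Adj G (f i) (f j) ⇔ Adj Banner i j
    upper _ zero ()
    upper zero (suc zero) _ = edge e01
    upper (suc _) (suc zero) (s≤s ())
    upper zero (suc (suc zero)) _ = edge e02
    upper (suc zero) (suc (suc zero)) _ = nonEdge n12
    upper (suc (suc _)) (suc (suc zero)) (s≤s (s≤s ()))
    upper zero (suc (suc (suc zero))) _ = edge e03
    upper (suc zero) (suc (suc (suc zero))) _ = nonEdge n13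
    upper (suc (suc zero)) (suc (suc (suc zero))) _ = nonEdge n23
    upper (suc (suc (suc _))) (suc (suc (suc zero))) (s≤s (s≤s (s≤s ())))
    upper zero (suc (suc (suc (suc zero)))) _ = nonEdge n04
    upper (suc zero) (suc (suc (suc (suc zero)))) _ = edge e14
    upper (suc (suc zero)) (suc (suc (suc (suc zero)))) _ = edge e24
    upper (suc (suc (suc zero))) (suc (suc (suc (suc zero)))) _ = nonEdge n34
    upper (suc (suc (suc (suc _)))) (suc (suc (suc (suc zero)))) (s≤s (s≤s (s≤s (s≤s ()))))

  -- Maximum stars in fork- and banner-free graphs

  CompleteTo : Subset n → Fin n → Set
  CompleteTo S x = ∀ {s} → s ∈ S → Adj G x s

  AnticompleteTo : Subset n → Fin n → Set
  AnticompleteTo S x = ∀ {s} → s ∈ S → ¬ Adj G x s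

  MixedOn : Subset n → Fin n → Set
  MixedOn S x = (∃[ s ] s ∈ S × Adj G x s) × (∃[ s ] s ∈ S × ¬ Adj G x s)

  classify : ∀ S x → CompleteTo S x ⊎ AnticompleteTo S x ⊎ MixedOn S x
  classify S x with Finₚ.any? (λ s → (s ∈? S) ×-dec ¬? (adj? G x s))
                  | Finₚ.any? (λ s → (s ∈? S) ×-dec adj? G x s)
  ... | no  noMiss | _        = inj₁ λ {s} s∈S → decidable-stable (adj? G x s) (λ x≁s → noMiss (s , s∈S , x≁s))
  ... | yes miss   | no noHit = inj₂ (inj₁ λ s∈S x~s → noHit (_ , s∈S , x~s))
  ... | yes miss   | yes hit  = inj₂ (inj₂ (hit , miss))

  independent⇒¬adj : Independent.IsHomogeneous S → Anticomplete S S
  independent⇒¬adj independent {x} {y} x∈S y∈S with x Finₚ.≟ y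
  ... | yes refl = irrefl G x
  ... | no  x≢y  = proj₁ (independent x∈S y∈S x≢y)

  ClawCentre : Subset n → Fin n → Set
  ClawCentre P v = Independent.Has (P ∩ N v) 3

  Star : Subset n → Subset n → Set
  Star P S = ∃[ c ] c ∈ P × S ⊆ P ∩ N c × Independent.IsHomogeneous S

  star? : ∀ P → Decidable (Star P)
  star? P S = Finₚ.any? λ c → (c ∈? P) ×-dec (S ⊆? P ∩ N c) ×-dec Independent.isHomogeneous? S

  module _ (fork-free : Fork -free G) (banner-free : Banner -free G) where

    complete-adj-mixed : ∀ {c} → Anticomplete S S → 2 < ∣ S ∣ → CompleteTo S c → MixedOn S x → Adj G c x
    complete-adj-mixed {S} {x} {c} s≁ 2<∣S∣ c~S ((s₁ , s₁∈S , x~s₁) , (s₂ , s₂∈S , x≁s₂))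
      with ∈-avoiding₂ 2<∣S∣ s₁ s₂
    ... | s₃ , s₃∈S , s₃≢s₁ , s₃≢s₂ with adj? G x s₃
    ...   | yes x~s₃ = decidable-stable (adj? G c x) λ c≁x →
      ¬banner banner-free (s₃≢s₁ ∘ sym) (c~S s₁∈S) (c~S s₃∈S) (c~S s₂∈S) c≁x
              (s≁ s₁∈S s₃∈S) (s≁ s₁∈S s₂∈S) (adj-sym x~s₁) (s≁ s₃∈S s₂∈S) (adj-sym x~s₃) (x≁s₂ ∘ adj-sym)
    ...   | no x≁s₃ = decidable-stable (adj? G c x) λ c≁x →
      ¬fork fork-free (s₃≢s₂ ∘ sym) (c~S s₂∈S) (c~S s₃∈S) (c~S s₁∈S) c≁x
            (s≁ s₂∈S s₃∈S) (s≁ s₂∈S s₁∈S) (x≁s₂ ∘ adj-sym) (s≁ s₃∈S s₁∈S) (x≁s₃ ∘ adj-sym) (adj-sym x~s₁)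

    module MaximumStar {P S : Subset n} {c₀ : Fin n} (c₀∈P : c₀ ∈ P) (S⊆P∩Nc₀ : S ⊆ P ∩ N c₀)
                       (S-independent : Independent.IsHomogeneous S) (2<∣S∣ : 2 < ∣ S ∣)
                       (maximal : ∀ {c} → c ∈ P → α[ P ∩ N c ]≤ ∣ S ∣) where

      S⊆P : S ⊆ P
      S⊆P = p∩q⊆p P (N c₀) ∘ S⊆P∩Nc₀

      c₀~S : CompleteTo S c₀
      c₀~S = ∈toSubset⁻ (adj? G c₀) ∘ p∩q⊆q P (N c₀) ∘ S⊆P∩Nc₀

      S≁S : Anticomplete S S
      S≁S = independent⇒¬adj S-independent

      InD : Fin n → Set
      InD x = x ∈ P × x ∉ S × AnticompleteTo S x

      InM : Fin n → Set
      InM x = x ∈ P × MixedOn S x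

      D-nonAdj-S : ∀ {d s} → InD d → s ∈ S → NonAdj d s
      D-nonAdj-S (_ , d∉S , d≁S) s∈S = d≁S s∈S , λ { refl → d∉S s∈S }

      D-¬adj-complete : ∀ {d c} → InD d → c ∈ P → CompleteTo S c → ¬ Adj G d c
      D-¬adj-complete {d} {c} dD@(d∈P , _ , _) c∈P c~S d~c =
        maximal c∈P (Independent.has-⊆ ⁅d⁆∪S⊆P∩Nc
          (Independent.has-∪ cross (Independent.has-⁅⁆ d) (Independent.has-self S-independent)))
        where
        cross : ∀ {y s} → y ∈ ⁅ d ⁆ → s ∈ S → NonAdj y s
        cross y∈⁅d⁆ s∈S rewrite x∈⁅y⁆⇒x≡y d y∈⁅d⁆ = D-nonAdj-S dD s∈S
        ⁅d⁆∪S⊆P∩Nc : ⁅ d ⁆ ∪ S ⊆ P ∩ N c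
        ⁅d⁆∪S⊆P∩Nc = ⁅x⁆∪p⊆q (∈P∩N d∈P (adj-sym d~c)) (λ s∈S → ∈P∩N (S⊆P s∈S) (c~S s∈S))

      c₀≁D : ∀ {d} → InD d → ¬ Adj G c₀ d
      c₀≁D dD = D-¬adj-complete dD c₀∈P c₀~S ∘ adj-sym

      c₀~M : ∀ {m} → InM m → Adj G c₀ m
      c₀~M (_ , mixed) = complete-adj-mixed S≁S 2<∣S∣ c₀~S mixed

      MissesOnly : Fin n → Fin n → Set
      MissesOnly m s₀ = s₀ ∈ S × ¬ Adj G m s₀ × (∀ {s} → s ∈ S → s ≢ s₀ → Adj G m s)

      missesOnlyOne : ∀ {m d} → InM m → InD d → Adj G m d → ∃[ s₀ ] MissesOnly m s₀
      missesOnlyOne {m} mM@(_ , _ , (s₀ , s₀∈S , m≁s₀)) dD@(_ , _ , d≁S) m~d = s₀ , s₀∈S , m≁s₀ , m~S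
        where
        m~S : ∀ {s} → s ∈ S → s ≢ s₀ → Adj G m s
        m~S {s} s∈S s≢s₀ = decidable-stable (adj? G m s) λ m≁s →
          ¬fork fork-free (s≢s₀ ∘ sym) (c₀~S s₀∈S) (c₀~S s∈S) (c₀~M mM) (c₀≁D dD) (S≁S s₀∈S s∈S)
                (m≁s₀ ∘ adj-sym) (d≁S s₀∈S ∘ adj-sym) (m≁s ∘ adj-sym) (d≁S s∈S ∘ adj-sym) m~d

      D-neighbour-adj-M : ∀ {m d e} → InM m → InD d → Adj G m d → InD e → Adj G d e → Adj G m e
      D-neighbour-adj-M {m} {e = e} mM dD@(_ , _ , d≁S) m~d (_ , _ , e≁S) d~e with missesOnlyOne mM dD m~d
      ... | s₀ , _ , _ , m~S with ∈-avoiding (≤-trans (n≤1+n 2) 2<∣S∣) s₀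
      ...   | s₁ , s₁∈S , s₁≢s₀ with ∈-avoiding₂ 2<∣S∣ s₀ s₁
      ...     | s₂ , s₂∈S , s₂≢s₀ , s₂≢s₁ = decidable-stable (adj? G m e) λ m≁e →
        ¬fork fork-free (s₂≢s₁ ∘ sym) (m~S s₁∈S s₁≢s₀) (m~S s₂∈S s₂≢s₀) m~d m≁e (S≁S s₁∈S s₂∈S)
              (d≁S s₁∈S ∘ adj-sym) (e≁S s₁∈S ∘ adj-sym) (d≁S s₂∈S ∘ adj-sym) (e≁S s₂∈S ∘ adj-sym) d~e

      M-neighbours-adjacent : ∀ {d m₁ m₂} → InD d → InM m₁ → InM m₂ → Adj G d m₁ → Adj G d m₂ → m₁ ≢ m₂ →
                              Adj G m₁ m₂
      M-neighbours-adjacent {m₁ = m₁} {m₂} dD@(_ , d∉S , d≁S) m₁M m₂M d~m₁ d~m₂ m₁≢m₂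
        with missesOnlyOne m₁M dD (adj-sym d~m₁) | missesOnlyOne m₂M dD (adj-sym d~m₂)
      ... | t₁ , t₁∈S , m₁≁t₁ , m₁~S | t₂ , t₂∈S , m₂≁t₂ , m₂~S with t₁ Finₚ.≟ t₂
      ...   | yes refl = decidable-stable (adj? G m₁ m₂) λ m₁≁m₂ →
        ¬banner banner-free m₁≢m₂ (c₀~M m₁M) (c₀~M m₂M) (c₀~S t₁∈S) (c₀≁D dD) m₁≁m₂ m₁≁t₁
                (adj-sym d~m₁) m₂≁t₂ (adj-sym d~m₂) (d≁S t₁∈S ∘ adj-sym)
      ...   | no t₁≢t₂ with ∈-avoiding₂ 2<∣S∣ t₁ t₂
      ...     | s , s∈S , s≢t₁ , s≢t₂ = decidable-stable (adj? G m₁ m₂) λ m₁≁m₂ →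
        ¬banner banner-free (λ { refl → d∉S s∈S }) (adj-sym d~m₁) (m₁~S s∈S s≢t₁) (m₁~S t₂∈S (t₁≢t₂ ∘ sym))
                m₁≁m₂ (d≁S s∈S) (d≁S t₂∈S) d~m₂ (S≁S s∈S t₂∈S) (adj-sym (m₂~S s∈S s≢t₂)) (m₂≁t₂ ∘ adj-sym)

      -- Otherwise (S − s₀) ∪ {e₁, e₂} is a larger independent set in the neighbourhood of m.
      D-neighbours-adjacent : ∀ {d m e₁ e₂} → InD d → InM m → Adj G d m → InD e₁ → InD e₂ →
                              Adj G d e₁ → Adj G d e₂ → e₁ ≢ e₂ → Adj G e₁ e₂
      D-neighbours-adjacent {d} {m} {e₁} {e₂} dD mM@(m∈P , _) d~m e₁D e₂D d~e₁ d~e₂ e₁≢e₂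
        with missesOnlyOne mM dD (adj-sym d~m)
      ... | s₀ , _ , _ , m~S = decidable-stable (adj? G e₁ e₂) (maximal m∈P ∘ largerStar)
        where
        S₀ = S - s₀
        S₀⊆S : S₀ ⊆ S
        S₀⊆S = p─q⊆p S ⁅ s₀ ⁆
        S₀⊆P∩Nm : S₀ ⊆ P ∩ N m
        S₀⊆P∩Nm s∈S₀ = ∈P∩N (S⊆P (S₀⊆S s∈S₀)) (m~S (S₀⊆S s∈S₀) (x∈p-y⇒x≢y s∈S₀))
        e∈P∩Nm : ∀ {e} → InD e → Adj G d e → e ∈ P ∩ N m
        e∈P∩Nm eD@(e∈P , _) d~e = ∈P∩N e∈P (D-neighbour-adj-M mM dD (adj-sym d~m) eD d~e)
        largerStar : ¬ Adj G e₁ e₂ → Independent.Has (P ∩ N m) (suc ∣ S ∣)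
        largerStar e₁≁e₂ =
          Independent.has-⊆ (⁅x⁆∪p⊆q (e∈P∩Nm e₁D d~e₁) (⁅x⁆∪p⊆q (e∈P∩Nm e₂D d~e₂) S₀⊆P∩Nm))
            (Independent.has-≤ (s≤s (∣p∣≤1+∣p-x∣ S s₀))
              (Independent.has-∪ e₁-cross (Independent.has-⁅⁆ e₁)
                (Independent.has-∪ e₂-cross (Independent.has-⁅⁆ e₂)
                  (Independent.has-self (Independent.isHomogeneous-⊆ S₀⊆S S-independent)))))
          where
          e₂-cross : ∀ {y s} → y ∈ ⁅ e₂ ⁆ → s ∈ S₀ → NonAdj y s
          e₂-cross y∈⁅e₂⁆ s∈S₀ rewrite x∈⁅y⁆⇒x≡y e₂ y∈⁅e₂⁆ = D-nonAdj-S e₂D (S₀⊆S s∈S₀)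
          e₁-cross : ∀ {y z} → y ∈ ⁅ e₁ ⁆ → z ∈ ⁅ e₂ ⁆ ∪ S₀ → NonAdj y z
          e₁-cross y∈⁅e₁⁆ z∈ rewrite x∈⁅y⁆⇒x≡y e₁ y∈⁅e₁⁆ with x∈⁅y⁆∪p⁻ z∈
          ... | inj₁ refl  = e₁≁e₂ , e₁≢e₂
          ... | inj₂ z∈S₀ = D-nonAdj-S e₁D (S₀⊆S z∈S₀)

      D-neighbour : ∀ {d x} → InD d → x ∈ P → Adj G d x → InD x ⊎ InM x
      D-neighbour dD@(_ , _ , d≁S) x∈P d~x with classify S _
      ... | inj₁ x~S          = ⊥-elim (D-¬adj-complete dD x∈P x~S d~x)
      ... | inj₂ (inj₁ x≁S)   = inj₁ (x∈P , (λ x∈S → d≁S x∈S d~x) , x≁S)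
      ... | inj₂ (inj₂ mixed) = inj₂ (x∈P , mixed)

      -- A claw at d has three leaves in D ∪ M; two lie in the same part, hence are adjacent.
      D~M⇒clawFree : ∀ {d m} → InD d → InM m → Adj G d m → ¬ ClawCentre P d
      D~M⇒clawFree {d} dD mM d~m (Q , Q⊆P∩Nd , Q-independent , 2<∣Q∣)
        with 0<∣p∣⇒Nonempty (≤-trans (s≤s z≤n) 2<∣Q∣)
      ... | a , a∈Q with ∈-avoiding (≤-trans (n≤1+n 2) 2<∣Q∣) a
      ...   | b , b∈Q , b≢a with ∈-avoiding₂ 2<∣Q∣ a b
      ...     | c , c∈Q , c≢a , c≢b = pigeonhole (type a∈Q) (type b∈Q) (type c∈Q)
        where
        Q≁Q : Anticomplete Q Q
        Q≁Q = independent⇒¬adj Q-independent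
        nbr : ∀ {x} → x ∈ Q → Adj G d x
        nbr x∈Q = ∈toSubset⁻ (adj? G d) (p∩q⊆q P (N d) (Q⊆P∩Nd x∈Q))
        type : ∀ {x} → x ∈ Q → InD x ⊎ InM x
        type x∈Q = D-neighbour dD (p∩q⊆p P (N d) (Q⊆P∩Nd x∈Q)) (nbr x∈Q)
        sameD : ∀ {x y} → x ∈ Q → y ∈ Q → x ≢ y → InD x → InD y → ⊥
        sameD x∈Q y∈Q x≢y xD yD = Q≁Q x∈Q y∈Q (D-neighbours-adjacent dD mM d~m xD yD (nbr x∈Q) (nbr y∈Q) x≢y)
        sameM : ∀ {x y} → x ∈ Q → y ∈ Q → x ≢ y → InM x → InM y → ⊥
        sameM x∈Q y∈Q x≢y xM yM = Q≁Q x∈Q y∈Q (M-neighbours-adjacent dD xM yM (nbr x∈Q) (nbr y∈Q) x≢y)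
        pigeonhole : InD a ⊎ InM a → InD b ⊎ InM b → InD c ⊎ InM c → ⊥
        pigeonhole (inj₁ aD) (inj₁ bD) _         = sameD b∈Q a∈Q b≢a bD aD
        pigeonhole (inj₂ aM) (inj₂ bM) _         = sameM b∈Q a∈Q b≢a bM aM
        pigeonhole (inj₁ aD) _         (inj₁ cD) = sameD c∈Q a∈Q c≢a cD aD
        pigeonhole (inj₂ aM) _         (inj₂ cM) = sameM c∈Q a∈Q c≢a cM aM
        pigeonhole _         (inj₁ bD) (inj₁ cD) = sameD c∈Q b∈Q c≢b cD bD
        pigeonhole _         (inj₂ bM) (inj₂ cM) = sameM c∈Q b∈Q c≢b cM bM

      inD? : ∀ x → Dec (InD x)
      inD? x = (x ∈? P) ×-dec ¬? (x ∈? S) ×-dec Lift? (¬? ∘ adj? G x) S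

      inM? : ∀ x → Dec (InM x)
      inM? x = (x ∈? P) ×-dec Finₚ.any? (λ s → (s ∈? S) ×-dec adj? G x s)
                        ×-dec Finₚ.any? (λ s → (s ∈? S) ×-dec ¬? (adj? G x s))

      D : Subset n
      D = toSubset inD?

      inC? : ∀ x → Dec (x ∈ P × CompleteTo S x)
      inC? x = (x ∈? P) ×-dec Lift? (adj? G x) S

      C : Subset n
      C = toSubset inC?

      D≁P─D : ¬ (∃[ d ] ∃[ m ] InD d × InM m × Adj G d m) → Anticomplete D (P ─ D)
      D≁P─D noEdge {x} {y} x∈D y∈P─D x~y with D-neighbour (∈toSubset⁻ inD? x∈D) (p─q⊆p P D y∈P─D) x~y
      ... | inj₁ yD = x∈p─q⇒x∉q P D y∈P─D (∈toSubset⁺ inD? yD)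
      ... | inj₂ yM = noEdge (x , y , ∈toSubset⁻ inD? x∈D , yM , x~y)

      C~P─C : Empty D → Complete C (P ─ C)
      C~P─C noD {x} {y} x∈C y∈P─C with ∈toSubset⁻ inC? x∈C | y ∈? S
      ... | _ , x~S | yes y∈S = x~S y∈S
      ... | _ , x~S | no  y∉S with classify S y
      ...   | inj₁ y~S          = ⊥-elim (x∈p─q⇒x∉q P C y∈P─C (∈toSubset⁺ inC? (p─q⊆p P C y∈P─C , y~S)))
      ...   | inj₂ (inj₁ y≁S)   = ⊥-elim (noD (y , ∈toSubset⁺ inD? (p─q⊆p P C y∈P─C , y∉S , y≁S)))
      ...   | inj₂ (inj₂ mixed) = complete-adj-mixed S≁S 2<∣S∣ x~S mixed

      split : (∀ {v} → v ∈ P → ClawCentre P v) → Split P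
      split clawCentre with Finₚ.any? (λ d → Finₚ.any? λ m → inD? d ×-dec inM? m ×-dec adj? G d m)
                          | 0<∣p∣⇒Nonempty (≤-trans (s≤s z≤n) 2<∣S∣)
      ... | yes (d , m , dD , mM , d~m) | _ = ⊥-elim (D~M⇒clawFree dD mM d~m (clawCentre (proj₁ dD)))
      ... | no noEdge | s , s∈S with nonempty? D
      ...   | yes nonemptyD =
        anticomplete (proj₁ ∘ ∈toSubset⁻ inD? , s , S⊆P s∈S , s∉D) nonemptyD (D≁P─D noEdge)
        where
        s∉D : s ∉ D
        s∉D s∈D = proj₁ (proj₂ (∈toSubset⁻ inD? s∈D)) s∈S
      ...   | no noD =
        complete (proj₁ ∘ ∈toSubset⁻ inC? , s , S⊆P s∈S , s∉C) (c₀ , ∈toSubset⁺ inC? (c₀∈P , c₀~S)) (C~P─C noD)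
        where
        s∉C : s ∉ C
        s∉C s∈C = irrefl G s (proj₂ (∈toSubset⁻ inC? s∈C) s∈S)

    clawCentres⇒split : (∀ {v} → v ∈ P → ClawCentre P v) → u ∈ P → Split P
    clawCentres⇒split {P} clawCentre u∈P with clawCentre u∈P
    ... | S₀ , S₀⊆P∩Nu , S₀-independent , 3≤∣S₀∣
      with maximum (star? P) (_ , u∈P , S₀⊆P∩Nu , S₀-independent)
    ...   | S , (c₀ , c₀∈P , S⊆P∩Nc₀ , S-independent) , largest =
      MaximumStar.split c₀∈P S⊆P∩Nc₀ S-independent
        (≤-trans 3≤∣S₀∣ (largest (_ , u∈P , S₀⊆P∩Nu , S₀-independent))) maximal clawCentre
      where
      maximal : ∀ {c} → c ∈ P → α[ P ∩ N c ]≤ ∣ S ∣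
      maximal c∈P (Q , Q⊆P∩Nc , Q-independent , 1+∣S∣≤∣Q∣) =
        <⇒≱ 1+∣S∣≤∣Q∣ (largest (_ , c∈P , Q⊆P∩Nc , Q-independent))

    χ≤ω² : ∀ P → Acc _<_ ∣ P ∣ → ∀ k → ω[ P ]≤ k → χ[ P ]≤ k * k
    χ≤ω² P (acc smaller) k ω≤k with Finₚ.any? (λ v → (v ∈? P) ×-dec ¬? (Independent.has? (P ∩ N v) 3))
    ... | yes (v , v∈P , clawFree) =
      χ-extend v∈P (degree<k² v∈P clawFree ω≤k)
        (χ≤ω² (P - v) (smaller (x∈p⇒∣p-x∣<∣p∣ v∈P)) k (Clique.bounded-⊆ (p─q⊆p P ⁅ v ⁆) ω≤k))
    ... | no noClawFree with nonempty? P
    ...   | no  empty    = χ-empty empty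
    ...   | yes (u , u∈P) = χ-split (clawCentres⇒split clawCentre u∈P) (λ Q → χ≤ω² Q ∘ smaller) ω≤k
      where
      clawCentre : ∀ {v} → v ∈ P → ClawCentre P v
      clawCentre v∈P = decidable-stable (Independent.has? _ 3) λ clawFree → noClawFree (_ , v∈P , clawFree)

mainTheorem9 : (n : ℕ) (G : Graph n) (w : ℕ) →
    Fork -free G → Banner -free G → CliqueNumber G w → χ≤ G (w * w)
mainTheorem9 n G w fork-free banner-free (_ , noLargerClique) =
  χ[⊤]⇒Colouring G (χ≤ω² G fork-free banner-free Subset.⊤ (<-wellFounded _) w (¬Clique⇒ω[⊤]≤ G noLargerClique))
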